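{- Let $q\ge 2$ be an integer and let $f(x)\in\mathbf{Q}[x]$ be a polynomial with $f(0)=1$ such that the power series $\prod_{s=0}^{\infty}f(x^{q^{s}})$ is $q$-automatic. Then all coefficients of $f$ belong to $\mathbf{Z}$.
   Context: The infinite product is a formal power series. A power series $\sum c_nx^n$ is $q$-automatic if the set $\{(c_{q^l n+b})_{n\in\mathbf{N}} : l\in\mathbf{N},\ 0\le b<q^l\}$ is finite. -}

module Defs where

open import Data.Nat using (ℕ; zero; suc; _+_; _*_; _^_; _≟_; _<_)
open import Data.Integer using (ℤ)
open import Data.Rational using (ℚ; 0ℚ; 1ℚ) renaming (_+_ to _+ℚ_; _*_ to _*ℚ_)
import Data.Rational as Q
open import Data.List using (List; []; _∷_)
open import Data.List.Membership.Propositional using (_∈_)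
open import Data.Product using (Σ; ∃; _×_)
open import Relation.Nullary using (yes; no)
open import Relation.Binary.PropositionalEquality using (_≡_)

-- A polynomial in ℚ[x] is represented by its list of coefficients
-- [a₀, a₁, …, a_d] (constant term first).
Poly : Set
Poly = List ℚ

coeff : Poly → ℕ → ℚ
coeff []       _       = 0ℚ
coeff (a ∷ _)  zero    = a
coeff (_ ∷ as) (suc d) = coeff as d

sumUpTo : ℕ → (ℕ → ℚ) → ℚ
sumUpTo zero    g = g zero
sumUpTo (suc n) g = sumUpTo n g +ℚ g (suc n)

PowerSeries : Set
PowerSeries = ℕ → ℚ

-- partialProdCoeff q f K n = coefficient of x^n in  ∏_{s=0}^{K-1} f(x^{q^s}).
-- Uses  ∏_{s<K+1} f(x^{q^s}) = f(x) · (∏_{s<K} f(y^{q^s}))[y := x^q],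
-- so the coefficient of x^n is  Σ_{d + q m = n} a_d · c_K(m).
partialProdCoeff : ℕ → Poly → ℕ → ℕ → ℚ
partialProdCoeff q f zero n with n ≟ 0
... | yes _ = 1ℚ
... | no  _ = 0ℚ
partialProdCoeff q f (suc K) n =
  sumUpTo n λ m → sumUpTo n λ d → term m d
  where
  term : ℕ → ℕ → ℚ
  term m d with d + q * m ≟ n
  ... | yes _ = coeff f d *ℚ partialProdCoeff q f K m
  ... | no  _ = 0ℚ

-- The infinite product  ∏_{s=0}^{∞} f(x^{q^s})  as a formal power series
-- (for f(0) = 1 and q ≥ 2): the coefficient of x^n stabilises once all
-- factors with q^s ≤ n are included; the factors s = 0, …, n suffice
-- since q^s ≥ 2^s > n for s > n.
infProd : ℕ → Poly → PowerSeries
infProd q f n = partialProdCoeff q f (suc n) n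

-- q-automatic: the q-kernel  { (c_{q^l n + b})_{n ∈ ℕ} : l ∈ ℕ, 0 ≤ b < q^l }
-- is a finite set of sequences, i.e. it is covered by a finite list of
-- sequences (sequences compared extensionally).
IsAutomatic : ℕ → PowerSeries → Set
IsAutomatic q c =
  Σ (List PowerSeries) λ L →
    ∀ (l b : ℕ) → b < q ^ l →
      Σ PowerSeries λ g → (g ∈ L) × (∀ n → c (q ^ l * n + b) ≡ g n)

IsInteger : ℚ → Set
IsInteger r = ∃ λ (z : ℤ) → r ≡ z Q./ 1

-- F(x) = ∏ f(x^{q^s}) satisfies F(x) = f(x) F(x^q). Since F_n is the first term of the
-- kernel sequence (F_{q^n m + n})_m, the coefficients of F take finitely many values, so
-- H = D·F lies in ℤ[[x]] for some D ≥ 1; with g = E·f ∈ ℤ[x] this gives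
-- E·H(x) = g(x) H(x^q) and H_0 = D ≠ 0. Let p be a prime factor of E. If p ∤ g_i for some
-- i, take t least with p ∤ g_t and j least with p ∤ H_j: in the coefficient of x^{t+qj}
-- every term but g_t H_j is divisible by p, and so is E·H_{t+qj}, which is absurd. So p
-- divides H, and applying this to H/p, H/p², … contradicts H ≠ 0. Hence p divides every
-- g_i; dividing E and g by p and recursing over the prime factors of E shows E ∣ g_i.
module Submission where

open import Defs

open import Data.Nat as ℕ using (ℕ; zero; suc; _≤_; _<_; z≤n; s≤s; _≟_; NonZero)
import Data.Nat.Properties as ℕP
import Data.Nat.Divisibility as ℕD
open import Data.Nat.Primality using (Prime; euclidsLemma; prime⇒nonZero; prime⇒nonTrivial)
open import Data.Nat.Primality.Factorisation using (factorise; PrimeFactorisation)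
open import Data.Nat.ListAction using (product)
open import Data.Integer as ℤ using (ℤ; +_; 0ℤ; _*_; _+_)
import Data.Integer.Properties as ℤP
open import Data.Integer.Divisibility.Signed
  using (_∣_; divides; _∣?_; ∣ᵤ⇒∣; ∣⇒∣ᵤ; ∣m∣n⇒∣m+n; ∣m+n∣m⇒∣n; ∣m+n∣n⇒∣m; ∣n⇒∣m*n; ∣m⇒∣m*n
        ; *-monoˡ-∣)
open import Data.Integer.Tactic.RingSolver using (solve-∀)
open import Data.Rational as ℚ using (ℚ; 0ℚ; 1ℚ; ↥_; ↧ₙ_; toℚᵘ; fromℚᵘ)
  renaming (_+_ to _+ℚ_; _*_ to _*ℚ_)
import Data.Rational.Properties as ℚP
open import Data.Rational.Unnormalised as ℚᵘ using (ℚᵘ; mkℚᵘ; *≡*)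
import Data.Rational.Unnormalised.Properties as ℚᵘP
open import Data.List using ([]; _∷_; map; length)
open import Data.List.Relation.Unary.All as All using (All; []; _∷_)
open import Data.List.Membership.Propositional.Properties using (∈-map⁺)
open import Data.Product using (∃; _×_; _,_; proj₁; proj₂)
open import Data.Sum using (_⊎_; inj₁; inj₂)
open import Data.Empty using (⊥-elim)
open import Function using (_∘_)
open import Relation.Binary.Definitions using (tri<; tri≈; tri>)
open import Relation.Binary.PropositionalEquality
open import Relation.Nullary using (¬_; yes; no)
open import Relation.Unary using (Decidable)

minimal-counterexample : {P : ℕ → Set} → Decidable P → ∀ N →
  (∀ i → i < N → P i) ⊎ ∃ λ t → ¬ P t × (∀ i → i < t → P i)
minimal-counterexample P? zero = inj₁ λ _ ()
minimal-counterexample {P} P? (suc N) with minimal-counterexample P? N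
... | inj₂ counterexample = inj₂ counterexample
... | inj₁ P<N with P? N
...   | no ¬PN = inj₂ (N , ¬PN , P<N)
...   | yes PN = inj₁ λ i i<1+N → case i (ℕP.m<1+n⇒m<n∨m≡n i<1+N)
  where
  case : ∀ i → i < N ⊎ i ≡ N → P i
  case i (inj₁ i<N)  = P<N i i<N
  case i (inj₂ refl) = PN

sumUpToℤ : ℕ → (ℕ → ℤ) → ℤ
sumUpToℤ zero    φ = φ zero
sumUpToℤ (suc n) φ = sumUpToℤ n φ + φ (suc n)

sumUpToℤ-cong : ∀ n {φ ψ : ℕ → ℤ} → (∀ i → φ i ≡ ψ i) → sumUpToℤ n φ ≡ sumUpToℤ n ψ
sumUpToℤ-cong zero    φ≗ψ = φ≗ψ zero
sumUpToℤ-cong (suc n) φ≗ψ = cong₂ _+_ (sumUpToℤ-cong n φ≗ψ) (φ≗ψ (suc n))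

sumUpToℤ-*ʳ : ∀ n (φ : ℕ → ℤ) c → sumUpToℤ n (λ i → φ i * c) ≡ sumUpToℤ n φ * c
sumUpToℤ-*ʳ zero    φ c = refl
sumUpToℤ-*ʳ (suc n) φ c = trans (cong (_+ φ (suc n) * c) (sumUpToℤ-*ʳ n φ c))
                                 (sym (ℤP.*-distribʳ-+ c (sumUpToℤ n φ) (φ (suc n))))

∣-sumUpToℤ : ∀ {k} n {φ : ℕ → ℤ} → (∀ i → i ≤ n → k ∣ φ i) → k ∣ sumUpToℤ n φ
∣-sumUpToℤ zero    k∣φ = k∣φ zero z≤n
∣-sumUpToℤ (suc n) k∣φ =
  ∣m∣n⇒∣m+n (∣-sumUpToℤ n λ i i≤n → k∣φ i (ℕP.m≤n⇒m≤1+n i≤n)) (k∣φ (suc n) ℕP.≤-refl)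

∣-summand : ∀ {k} n {φ : ℕ → ℤ} i → i ≤ n → (∀ j → j ≢ i → k ∣ φ j) →
            k ∣ sumUpToℤ n φ → k ∣ φ i
∣-summand zero    zero z≤n _ k∣Σ = k∣Σ
∣-summand (suc n) i i≤1+n k∣φ≢i k∣Σ with i ≟ suc n
... | yes refl = ∣m+n∣m⇒∣n k∣Σ (∣-sumUpToℤ n λ j j≤n → k∣φ≢i j (ℕP.<⇒≢ (s≤s j≤n)))
... | no  i≢1+n = ∣-summand n i (ℕP.≤-pred (ℕP.≤∧≢⇒< i≤1+n i≢1+n)) k∣φ≢i
                    (∣m+n∣n⇒∣m k∣Σ (k∣φ≢i (suc n) (i≢1+n ∘ sym)))

-- convℤ q g h n is the coefficient of xⁿ in g(x) · h(x^q).
convTermℤ : ℕ → (ℕ → ℤ) → (ℕ → ℤ) → ℕ → ℕ → ℕ → ℤ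
convTermℤ q g h n m d with d ℕ.+ q ℕ.* m ≟ n
... | yes _ = g d * h m
... | no  _ = 0ℤ

convℤ : ℕ → (ℕ → ℤ) → (ℕ → ℤ) → ℕ → ℤ
convℤ q g h n = sumUpToℤ n λ m → sumUpToℤ n (convTermℤ q g h n m)

convTermℤ-matching : ∀ q g h {n m d} → d ℕ.+ q ℕ.* m ≡ n → convTermℤ q g h n m d ≡ g d * h m
convTermℤ-matching q g h {n} {m} {d} d+qm≡n with d ℕ.+ q ℕ.* m ≟ n
... | yes _       = refl
... | no  d+qm≢n = ⊥-elim (d+qm≢n d+qm≡n)

convℤ-scale : ∀ q {g h g′ h′ : ℕ → ℤ} c → (∀ d m → g d * h m ≡ g′ d * h′ m * c) →
              ∀ n → convℤ q g h n ≡ convℤ q g′ h′ n * c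
convℤ-scale q {g} {h} {g′} {h′} c gh≡g′h′c n = begin
  convℤ q g h n
    ≡⟨ sumUpToℤ-cong n (λ m → sumUpToℤ-cong n (term-scale m)) ⟩
  (sumUpToℤ n λ m → sumUpToℤ n λ d → convTermℤ q g′ h′ n m d * c)
    ≡⟨ sumUpToℤ-cong n (λ m → sumUpToℤ-*ʳ n (convTermℤ q g′ h′ n m) c) ⟩
  (sumUpToℤ n λ m → sumUpToℤ n (convTermℤ q g′ h′ n m) * c)
    ≡⟨ sumUpToℤ-*ʳ n _ c ⟩
  convℤ q g′ h′ n * c ∎
  where
  open ≡-Reasoning
  term-scale : ∀ m d → convTermℤ q g h n m d ≡ convTermℤ q g′ h′ n m d * c
  term-scale m d with d ℕ.+ q ℕ.* m ≟ n
  ... | yes _ = gh≡g′h′c d m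
  ... | no  _ = sym (ℤP.*-zeroˡ c)

-- The denominator E divides g when E·H(x) = g(x) H(x^q)

euclidsLemmaℤ : ∀ {p} → Prime p → ∀ a b → + p ∣ a * b → + p ∣ a ⊎ + p ∣ b
euclidsLemmaℤ p-prime a b p∣ab
  with euclidsLemma ℤ.∣ a ∣ ℤ.∣ b ∣ p-prime (subst (_ ℕD.∣_) (ℤP.abs-* a b) (∣⇒∣ᵤ p∣ab))
... | inj₁ p∣a = inj₁ (∣ᵤ⇒∣ p∣a)
... | inj₂ p∣b = inj₂ (∣ᵤ⇒∣ p∣b)

n<m^n : ∀ {m} → 1 < m → ∀ n → n < m ℕ.^ n
n<m^n 1<m zero    = s≤s z≤n
n<m^n 1<m (suc n) = ℕP.≤-<-trans (n<m^n 1<m n) (ℕP.^-monoʳ-< _ 1<m (ℕP.n<1+n n))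

divisible-by-all-powers⇒≡0 : ∀ {p} → 1 < p → ∀ {z} → (∀ β → + (p ℕ.^ β) ∣ z) → z ≡ 0ℤ
divisible-by-all-powers⇒≡0 {p} 1<p {z} p^β∣z with ℤ.∣ z ∣ ℕ.≟ 0
... | yes ∣z∣≡0 = ℤP.∣i∣≡0⇒i≡0 ∣z∣≡0
... | no  ∣z∣≢0 = ⊥-elim (ℕP.<⇒≱ (n<m^n 1<p ℤ.∣ z ∣)
                    (ℕD.∣⇒≤ {{ℕ.≢-nonZero ∣z∣≢0}} (∣⇒∣ᵤ (p^β∣z ℤ.∣ z ∣))))

pos-*-swap : ∀ m n → + (m ℕ.* n) ≡ + n * + m
pos-*-swap m n = trans (ℤP.pos-* m n) (ℤP.*-comm (+ m) (+ n))

smaller-offset : ∀ {q} .{{_ : NonZero q}} {d m t j} →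
                 d ℕ.+ q ℕ.* m ≡ t ℕ.+ q ℕ.* j → j < m → d < t
smaller-offset {q} e j<m = ℕP.≰⇒> λ t≤d →
  ℕP.<-irrefl (sym e) (ℕP.+-mono-≤-< t≤d (ℕP.*-monoʳ-< q j<m))

module _ {q : ℕ} .{{_ : NonZero q}} {p : ℕ} (p-prime : Prime p) {E : ℤ} {g : ℕ → ℤ} {t : ℕ}
         (p∣E : + p ∣ E) (p∤gₜ : ¬ + p ∣ g t) (p∣g<t : ∀ i → i < t → + p ∣ g i) where

  prime-divides-solution : ∀ {H} → (∀ n → E * H n ≡ convℤ q g H n) → ∀ m → + p ∣ H m
  prime-divides-solution {H} E*H≡g∘H k with + p ∣? H k
  ... | yes p∣Hₖ = p∣Hₖ
  ... | no  p∤Hₖ with minimal-counterexample (λ l → + p ∣? H l) (suc k)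
  ...   | inj₁ p∣H≤k = ⊥-elim (p∤Hₖ (p∣H≤k k ℕP.≤-refl))
  ...   | inj₂ (j , p∤Hⱼ , p∣H<j) with euclidsLemmaℤ p-prime (g t) (H j) p∣gₜHⱼ
    where
    n : ℕ
    n = t ℕ.+ q ℕ.* j

    p∣off-diagonal : ∀ m d → (m ≡ j → d ≢ t) → + p ∣ convTermℤ q g H n m d
    p∣off-diagonal m d off with d ℕ.+ q ℕ.* m ≟ n
    ... | no  _ = ∣ᵤ⇒∣ (ℕD._∣0 p)
    ... | yes e with ℕP.<-cmp m j
    ...   | tri< m<j _ _ = ∣n⇒∣m*n (g d) (p∣H<j m m<j)
    ...   | tri≈ _ refl _ = ⊥-elim (off refl (ℕP.+-cancelʳ-≡ _ d t e))
    ...   | tri> _ _ j<m = ∣m⇒∣m*n (H m) (p∣g<t d (smaller-offset e j<m))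

    p∣gₜHⱼ : + p ∣ g t * H j
    p∣gₜHⱼ = subst (+ p ∣_) (convTermℤ-matching q g H refl)
      (∣-summand n t (ℕP.m≤m+n t _) (λ d d≢t → p∣off-diagonal j d (λ _ → d≢t))
        (∣-summand n j (ℕP.≤-trans (ℕP.m≤n*m j q) (ℕP.m≤n+m _ t))
          (λ m m≢j → ∣-sumUpToℤ n λ d _ → p∣off-diagonal m d (⊥-elim ∘ m≢j))
          (subst (+ p ∣_) (E*H≡g∘H n) (∣m⇒∣m*n (H n) p∣E))))
  ... | inj₁ p∣gₜ = ⊥-elim (p∤gₜ p∣gₜ)
  ... | inj₂ p∣Hⱼ = ⊥-elim (p∤Hⱼ p∣Hⱼ)

  prime-powers-divide-solution : ∀ β {H} → (∀ n → E * H n ≡ convℤ q g H n) →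
                                 ∀ m → + (p ℕ.^ β) ∣ H m
  prime-powers-divide-solution zero    _ m = ∣ᵤ⇒∣ (ℕD.1∣ _)
  prime-powers-divide-solution (suc β) {H} E*H≡g∘H m =
    subst₂ _∣_ (sym (pos-*-swap p (p ℕ.^ β))) (sym (H≡H′*p m))
      (*-monoˡ-∣ (+ p) (prime-powers-divide-solution β E*H′≡g∘H′ m))
    where
    H′ : ℕ → ℤ
    H′ k = _∣_.quotient (prime-divides-solution E*H≡g∘H k)

    H≡H′*p : ∀ k → H k ≡ H′ k * + p
    H≡H′*p k = _∣_.equality (prime-divides-solution E*H≡g∘H k)

    E*H′≡g∘H′ : ∀ n → E * H′ n ≡ convℤ q g H′ n
    E*H′≡g∘H′ n = ℤP.*-cancelʳ-≡ _ _ (+ p) {{prime⇒nonZero p-prime}} (begin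
      E * H′ n * + p    ≡⟨ ℤP.*-assoc E (H′ n) (+ p) ⟩
      E * (H′ n * + p)  ≡⟨ cong (E *_) (H≡H′*p n) ⟨
      E * H n           ≡⟨ E*H≡g∘H n ⟩
      convℤ q g H n     ≡⟨ convℤ-scale q (+ p) (λ d k → trans (cong (g d *_) (H≡H′*p k))
                                                        (sym (ℤP.*-assoc (g d) (H′ k) (+ p)))) n ⟩
      convℤ q g H′ n * + p ∎)
      where open ≡-Reasoning

module _ {q : ℕ} .{{_ : NonZero q}} {H : ℕ → ℤ} {m₀ : ℕ} (Hₘ₀≢0 : H m₀ ≢ 0ℤ) where

  product-divides-numerators : ∀ ps → All Prime ps → ∀ {g N} → (∀ i → N ≤ i → g i ≡ 0ℤ) →
    (∀ n → + product ps * H n ≡ convℤ q g H n) → ∀ i → + product ps ∣ g i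
  product-divides-numerators []       []                   _       _ i = ∣ᵤ⇒∣ (ℕD.1∣ _)
  product-divides-numerators (p ∷ ps) (p-prime ∷ ps-prime) {g} {N} g≥N≡0 E*H≡g∘H i
    with minimal-counterexample (λ k → + p ∣? g k) N
  ... | inj₂ (t , p∤gₜ , p∣g<t) = ⊥-elim (Hₘ₀≢0 (divisible-by-all-powers⇒≡0
          (ℕ.nonTrivial⇒n>1 p {{prime⇒nonTrivial p-prime}})
          λ β → prime-powers-divide-solution p-prime {E = + (p ℕ.* product ps)}
                  (∣ᵤ⇒∣ (ℕD.m∣m*n (product ps))) p∤gₜ p∣g<t β E*H≡g∘H m₀))
  ... | inj₁ p∣g<N = subst₂ _∣_ (sym (pos-*-swap p (product ps))) (sym (g≡g′*p i))
          (*-monoˡ-∣ (+ p) (product-divides-numerators ps ps-prime g′≥N≡0 E′*H≡g′∘H i))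
    where
    instance
      p≢0 : ℤ.NonZero (+ p)
      p≢0 = prime⇒nonZero p-prime

    p∣g : ∀ k → + p ∣ g k
    p∣g k with ℕP.<-≤-connex k N
    ... | inj₁ k<N = p∣g<N k k<N
    ... | inj₂ N≤k = subst (+ p ∣_) (sym (g≥N≡0 k N≤k)) (∣ᵤ⇒∣ (ℕD._∣0 p))

    g′ : ℕ → ℤ
    g′ k = _∣_.quotient (p∣g k)

    g≡g′*p : ∀ k → g k ≡ g′ k * + p
    g≡g′*p k = _∣_.equality (p∣g k)

    g′≥N≡0 : ∀ k → N ≤ k → g′ k ≡ 0ℤ
    g′≥N≡0 k N≤k = ℤP.*-cancelʳ-≡ (g′ k) 0ℤ (+ p) (trans (sym (g≡g′*p k)) (g≥N≡0 k N≤k))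

    E′*H≡g′∘H : ∀ n → + product ps * H n ≡ convℤ q g′ H n
    E′*H≡g′∘H n = ℤP.*-cancelʳ-≡ _ _ (+ p) (begin
      + product ps * H n * + p    ≡⟨ rearrange (+ product ps) (H n) (+ p) ⟩
      + product ps * + p * H n    ≡⟨ cong (_* H n) (pos-*-swap p (product ps)) ⟨
      + (p ℕ.* product ps) * H n  ≡⟨ E*H≡g∘H n ⟩
      convℤ q g H n               ≡⟨ convℤ-scale q (+ p) (λ d k → trans (cong (_* H k) (g≡g′*p d))
                                       (rearrange (g′ d) (+ p) (H k))) n ⟩
      convℤ q g′ H n * + p ∎)
      where
      open ≡-Reasoning
      rearrange : ∀ a b c → a * b * c ≡ a * c * b
      rearrange = solve-∀

  denominator-divides-numerators : ∀ E .{{_ : NonZero E}} {g N} → (∀ i → N ≤ i → g i ≡ 0ℤ) →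
    (∀ n → + E * H n ≡ convℤ q g H n) → ∀ i → + E ∣ g i
  denominator-divides-numerators E {g} g≥N≡0 =
    subst (λ e → (∀ n → + e * H n ≡ convℤ q g H n) → ∀ i → + e ∣ g i)
      (sym isFactorisation) (product-divides-numerators factors factorsPrime g≥N≡0)
    where open PrimeFactorisation (factorise E)

ι : ℤ → ℚ
ι z = z ℚ./ 1

private
  toℚᵘ-ι : ∀ z → toℚᵘ (ι z) ℚᵘ.≃ mkℚᵘ z 0
  toℚᵘ-ι z = ℚP.toℚᵘ-fromℚᵘ (mkℚᵘ z 0)

  ≡-fromℚᵘ : ∀ {x : ℚ} {u : ℚᵘ} → toℚᵘ x ℚᵘ.≃ u → x ≡ fromℚᵘ u
  ≡-fromℚᵘ {x} x≃u = trans (sym (ℚP.fromℚᵘ-toℚᵘ x)) (ℚP.fromℚᵘ-cong x≃u)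

ι-+ : ∀ a b → ι (a + b) ≡ ι a +ℚ ι b
ι-+ a b = sym (≡-fromℚᵘ {u = mkℚᵘ (a + b) 0} (ℚᵘP.≃-trans (ℚP.toℚᵘ-homo-+ (ι a) (ι b))
                       (ℚᵘP.≃-trans (ℚᵘP.+-cong (toℚᵘ-ι a) (toℚᵘ-ι b)) (*≡* (lemma a b)))))
  where
  lemma : ∀ a b → (a * + 1 + b * + 1) * + 1 ≡ (a + b) * (+ 1 * + 1)
  lemma = solve-∀

ι-* : ∀ a b → ι (a * b) ≡ ι a *ℚ ι b
ι-* a b = sym (≡-fromℚᵘ {u = mkℚᵘ (a * b) 0} (ℚᵘP.≃-trans (ℚP.toℚᵘ-homo-* (ι a) (ι b))
                       (ℚᵘP.≃-trans (ℚᵘP.*-cong (toℚᵘ-ι a) (toℚᵘ-ι b)) (*≡* (lemma a b)))))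
  where
  lemma : ∀ a b → a * b * + 1 ≡ a * b * (+ 1 * + 1)
  lemma = solve-∀

ι-injective : ∀ {a b} → ι a ≡ ι b → a ≡ b
ι-injective {a} {b} ιa≡ιb
  with ℚᵘP.≃-trans (ℚᵘP.≃-sym (toℚᵘ-ι a)) (ℚᵘP.≃-trans (ℚP.toℚᵘ-cong ιa≡ιb) (toℚᵘ-ι b))
... | *≡* a*1≡b*1 = trans (sym (ℤP.*-identityʳ a)) (trans a*1≡b*1 (ℤP.*-identityʳ b))

*ℚ-cancelˡ : ∀ a .{{_ : ℚ.NonZero a}} {x y} → a *ℚ x ≡ a *ℚ y → x ≡ y
*ℚ-cancelˡ a {x} {y} ax≡ay = begin
  x                 ≡⟨ ℚP.*-identityˡ x ⟨
  1ℚ *ℚ x           ≡⟨ cong (_*ℚ x) (ℚP.*-inverseˡ a) ⟨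
  ℚ.1/ a *ℚ a *ℚ x  ≡⟨ ℚP.*-assoc (ℚ.1/ a) a x ⟩
  ℚ.1/ a *ℚ (a *ℚ x) ≡⟨ cong (ℚ.1/ a *ℚ_) ax≡ay ⟩
  ℚ.1/ a *ℚ (a *ℚ y) ≡⟨ ℚP.*-assoc (ℚ.1/ a) a y ⟨
  ℚ.1/ a *ℚ a *ℚ y  ≡⟨ cong (_*ℚ y) (ℚP.*-inverseˡ a) ⟩
  1ℚ *ℚ y           ≡⟨ ℚP.*-identityˡ y ⟩
  y ∎
  where open ≡-Reasoning

_ClearsDenominatorOf_ : ℕ → ℚ → Set
D ClearsDenominatorOf x = IsInteger (ι (+ D) *ℚ x)

denominator-clears : ∀ x k → (↧ₙ x ℕ.* k) ClearsDenominatorOf x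
denominator-clears x@record{} k = ↥ x * + k ,
  ≡-fromℚᵘ {u = mkℚᵘ (↥ x * + k) 0} (ℚᵘP.≃-trans (ℚP.toℚᵘ-homo-* (ι (+ (↧ₙ x ℕ.* k))) x)
    (ℚᵘP.≃-trans (ℚᵘP.*-cong (toℚᵘ-ι (+ (↧ₙ x ℕ.* k))) (ℚᵘP.≃-refl {toℚᵘ x}))
      (*≡* (trans (cong (λ z → z * ↥ x * + 1) (ℤP.pos-* (↧ₙ x) k))
             (trans (lemma (↥ x) (+ ↧ₙ x) (+ k))
                    (cong ((↥ x * + k) *_) (sym (ℤP.pos-* 1 (↧ₙ x)))))))))
  where
  lemma : ∀ n d k → d * k * n * + 1 ≡ n * k * (+ 1 * d)
  lemma = solve-∀

clears-*ˡ : ∀ k {D x} → D ClearsDenominatorOf x → (k ℕ.* D) ClearsDenominatorOf x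
clears-*ˡ k {D} {x} (z , Dx≡z) = + k * z , (begin
  ι (+ (k ℕ.* D)) *ℚ x       ≡⟨ cong (λ c → ι c *ℚ x) (ℤP.pos-* k D) ⟩
  ι (+ k * + D) *ℚ x         ≡⟨ cong (_*ℚ x) (ι-* (+ k) (+ D)) ⟩
  ι (+ k) *ℚ ι (+ D) *ℚ x    ≡⟨ ℚP.*-assoc (ι (+ k)) (ι (+ D)) x ⟩
  ι (+ k) *ℚ (ι (+ D) *ℚ x)  ≡⟨ cong (ι (+ k) *ℚ_) Dx≡z ⟩
  ι (+ k) *ℚ ι z             ≡⟨ ι-* (+ k) z ⟨
  ι (+ k * z) ∎)
  where open ≡-Reasoning

clears-0ℚ : ∀ D → D ClearsDenominatorOf 0ℚ
clears-0ℚ D = 0ℤ , ℚP.*-zeroʳ (ι (+ D))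

common-denominator : ∀ xs → ∃ λ D → NonZero D × All (D ClearsDenominatorOf_) xs
common-denominator []       = 1 , _ , []
common-denominator (x ∷ xs) with common-denominator xs
... | D , D≢0 , D-clears = ↧ₙ x ℕ.* D , ℕP.m*n≢0 (↧ₙ x) D {{_}} {{D≢0}} ,
                           denominator-clears x D ∷ All.map (clears-*ˡ (↧ₙ x) {D}) D-clears

All-coeff : ∀ {P : ℚ → Set} {f} → All P f → P 0ℚ → ∀ i → P (coeff f i)
All-coeff []       P0 i       = P0
All-coeff (Pa ∷ _)  P0 zero    = Pa
All-coeff (_ ∷ Pf) P0 (suc i) = All-coeff Pf P0 i

coeff-≥length : ∀ f i → length f ≤ i → coeff f i ≡ 0ℚ
coeff-≥length []      i       _          = refl
coeff-≥length (_ ∷ f) (suc i) (s≤s f≤i) = coeff-≥length f i f≤i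

ι-nonZero : ∀ D .{{_ : NonZero D}} → ℚ.NonZero (ι (+ D))
ι-nonZero D = ℚ.≢-nonZero (ℕ.≢-nonZero⁻¹ D ∘ ℤP.+-injective ∘ ι-injective)

numerator-≡0 : ∀ {D x z} → ι (+ D) *ℚ x ≡ ι z → x ≡ 0ℚ → z ≡ 0ℤ
numerator-≡0 {D} Dx≡z refl = ι-injective (trans (sym Dx≡z) (ℚP.*-zeroʳ (ι (+ D))))

numerator-≢0 : ∀ {D} .{{_ : NonZero D}} {x z} → ι (+ D) *ℚ x ≡ ι z → x ≢ 0ℚ → z ≢ 0ℤ
numerator-≢0 {D} Dx≡z x≢0 refl =
  x≢0 (*ℚ-cancelˡ (ι (+ D)) {{ι-nonZero D}} (trans Dx≡z (sym (ℚP.*-zeroʳ (ι (+ D))))))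

cleared-numerator-divisible⇒integer : ∀ {D} .{{_ : NonZero D}} {x z} → ι (+ D) *ℚ x ≡ ι z →
                                      + D ∣ z → IsInteger x
cleared-numerator-divisible⇒integer {D} {x} {z} Dx≡z (divides w z≡wD) =
  w , *ℚ-cancelˡ (ι (+ D)) {{ι-nonZero D}} (begin
    ι (+ D) *ℚ x    ≡⟨ Dx≡z ⟩
    ι z             ≡⟨ cong ι (trans z≡wD (ℤP.*-comm w (+ D))) ⟩
    ι (+ D * w)     ≡⟨ ι-* (+ D) w ⟩
    ι (+ D) *ℚ ι w  ∎)
  where open ≡-Reasoning

-- The functional equation F(x) = f(x) F(x^q)

sumUpTo-cong : ∀ n {φ ψ : ℕ → ℚ} → (∀ i → φ i ≡ ψ i) → sumUpTo n φ ≡ sumUpTo n ψ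
sumUpTo-cong zero    φ≗ψ = φ≗ψ zero
sumUpTo-cong (suc n) φ≗ψ = cong₂ _+ℚ_ (sumUpTo-cong n φ≗ψ) (φ≗ψ (suc n))

sumUpTo-*ˡ : ∀ n c (φ : ℕ → ℚ) → c *ℚ sumUpTo n φ ≡ sumUpTo n (λ i → c *ℚ φ i)
sumUpTo-*ˡ zero    c φ = refl
sumUpTo-*ˡ (suc n) c φ = trans (ℚP.*-distribˡ-+ c (sumUpTo n φ) (φ (suc n)))
                               (cong (_+ℚ c *ℚ φ (suc n)) (sumUpTo-*ˡ n c φ))

ι-sumUpToℤ : ∀ n (φ : ℕ → ℤ) → ι (sumUpToℤ n φ) ≡ sumUpTo n (ι ∘ φ)
ι-sumUpToℤ zero    φ = refl
ι-sumUpToℤ (suc n) φ =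
  trans (ι-+ (sumUpToℤ n φ) (φ (suc n))) (cong (_+ℚ ι (φ (suc n))) (ι-sumUpToℤ n φ))

convTermℚ : ℕ → (ℕ → ℚ) → (ℕ → ℚ) → ℕ → ℕ → ℕ → ℚ
convTermℚ q a b n m d with d ℕ.+ q ℕ.* m ≟ n
... | yes _ = a d *ℚ b m
... | no  _ = 0ℚ

convℚ : ℕ → (ℕ → ℚ) → (ℕ → ℚ) → ℕ → ℚ
convℚ q a b n = sumUpTo n λ m → sumUpTo n (convTermℚ q a b n m)

convTermℚ-matching : ∀ q a b {n m d} → d ℕ.+ q ℕ.* m ≡ n → convTermℚ q a b n m d ≡ a d *ℚ b m
convTermℚ-matching q a b {n} {m} {d} d+qm≡n with d ℕ.+ q ℕ.* m ≟ n
... | yes _       = refl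
... | no  d+qm≢n = ⊥-elim (d+qm≢n d+qm≡n)

convℚ-congʳ : ∀ q a {b b′ : ℕ → ℚ} n → (∀ m → q ℕ.* m ≤ n → b m ≡ b′ m) →
              convℚ q a b n ≡ convℚ q a b′ n
convℚ-congʳ q a {b} {b′} n b≗b′ = sumUpTo-cong n λ m → sumUpTo-cong n (term-cong m)
  where
  term-cong : ∀ m d → convTermℚ q a b n m d ≡ convTermℚ q a b′ n m d
  term-cong m d with d ℕ.+ q ℕ.* m ≟ n
  ... | yes d+qm≡n = cong (a d *ℚ_) (b≗b′ m (subst (q ℕ.* m ≤_) d+qm≡n (ℕP.m≤n+m _ d)))
  ... | no  _      = refl

ι-convℤ : ∀ q {c c′ : ℚ} {a b : ℕ → ℚ} {g h : ℕ → ℤ} →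
          (∀ d → c *ℚ a d ≡ ι (g d)) → (∀ m → c′ *ℚ b m ≡ ι (h m)) →
          ∀ n → c *ℚ c′ *ℚ convℚ q a b n ≡ ι (convℤ q g h n)
ι-convℤ q {c} {c′} {a} {b} {g} {h} ca≡g c′b≡h n = begin
  c *ℚ c′ *ℚ convℚ q a b n
    ≡⟨ sumUpTo-*ˡ n (c *ℚ c′) _ ⟩
  (sumUpTo n λ m → c *ℚ c′ *ℚ sumUpTo n (convTermℚ q a b n m))
    ≡⟨ sumUpTo-cong n (λ m → trans (sumUpTo-*ˡ n (c *ℚ c′) _) (sumUpTo-cong n (term m))) ⟩
  (sumUpTo n λ m → sumUpTo n λ d → ι (convTermℤ q g h n m d))
    ≡⟨ sumUpTo-cong n (λ m → ι-sumUpToℤ n (convTermℤ q g h n m)) ⟨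
  (sumUpTo n λ m → ι (sumUpToℤ n (convTermℤ q g h n m)))
    ≡⟨ ι-sumUpToℤ n _ ⟨
  ι (convℤ q g h n) ∎
  where
  open ≡-Reasoning
  interchange : ∀ w x y z → w *ℚ x *ℚ (y *ℚ z) ≡ w *ℚ y *ℚ (x *ℚ z)
  interchange w x y z = begin
    w *ℚ x *ℚ (y *ℚ z)   ≡⟨ ℚP.*-assoc w x (y *ℚ z) ⟩
    w *ℚ (x *ℚ (y *ℚ z)) ≡⟨ cong (w *ℚ_) (ℚP.*-assoc x y z) ⟨
    w *ℚ (x *ℚ y *ℚ z)   ≡⟨ cong (λ v → w *ℚ (v *ℚ z)) (ℚP.*-comm x y) ⟩
    w *ℚ (y *ℚ x *ℚ z)   ≡⟨ cong (w *ℚ_) (ℚP.*-assoc y x z) ⟩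
    w *ℚ (y *ℚ (x *ℚ z)) ≡⟨ ℚP.*-assoc w y (x *ℚ z) ⟨
    w *ℚ y *ℚ (x *ℚ z)   ∎
  term : ∀ m d → c *ℚ c′ *ℚ convTermℚ q a b n m d ≡ ι (convTermℤ q g h n m d)
  term m d with d ℕ.+ q ℕ.* m ≟ n
  ... | yes _ = trans (interchange c c′ (a d) (b m))
                  (trans (cong₂ _*ℚ_ (ca≡g d) (c′b≡h m)) (sym (ι-* (g d) (h m))))
  ... | no  _ = ℚP.*-zeroʳ (c *ℚ c′)

-- The summand of partialProdCoeff is local to its definition; unification reads it off.
private
  summandOf : ∀ {r : ℚ} {n} {X : ℕ → ℕ → ℚ} → r ≡ sumUpTo n (λ m → sumUpTo n (X m)) → ℕ → ℕ → ℚ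
  summandOf {X = X} _ = X

partialProdCoeff-suc : ∀ q f K n →
  partialProdCoeff q f (suc K) n ≡ convℚ q (coeff f) (partialProdCoeff q f K) n
partialProdCoeff-suc q f K n = sumUpTo-cong n λ m → sumUpTo-cong n (summand-≡ m)
  where
  summand-≡ : ∀ m d → summandOf {n = n} (refl {x = partialProdCoeff q f (suc K) n}) m d ≡
                      convTermℚ q (coeff f) (partialProdCoeff q f K) n m d
  summand-≡ m d with d ℕ.+ q ℕ.* m ≟ n
  ... | yes _ = refl
  ... | no  _ = refl

module _ {q : ℕ} (1<q : 1 < q) {f : Poly} (f₀≡1 : coeff f 0 ≡ 1ℚ) where
  private
    instance
      q≢0 : NonZero q
      q≢0 = ℕ.>-nonZero (ℕP.<⇒≤ 1<q)

  partialProdCoeff-stable : ∀ K n → n < q ℕ.^ K →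
                            partialProdCoeff q f (suc K) n ≡ partialProdCoeff q f K n
  partialProdCoeff-stable zero    zero    _ = begin
    partialProdCoeff q f 1 0                       ≡⟨ partialProdCoeff-suc q f 0 0 ⟩
    convTermℚ q (coeff f) (partialProdCoeff q f 0) 0 0 0
      ≡⟨ convTermℚ-matching q (coeff f) (partialProdCoeff q f 0) (ℕP.*-zeroʳ q) ⟩
    coeff f 0 *ℚ 1ℚ                                ≡⟨ cong (_*ℚ 1ℚ) f₀≡1 ⟩
    1ℚ ∎
    where open ≡-Reasoning
  partialProdCoeff-stable zero    (suc n) (s≤s ())
  partialProdCoeff-stable (suc K) n n<q^1+K = begin
    partialProdCoeff q f (2 ℕ.+ K) n                   ≡⟨ partialProdCoeff-suc q f (suc K) n ⟩
    convℚ q (coeff f) (partialProdCoeff q f (suc K)) n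
      ≡⟨ convℚ-congʳ q (coeff f) n (λ m qm≤n → partialProdCoeff-stable K m
           (ℕP.*-cancelˡ-< q m (q ℕ.^ K) (ℕP.≤-<-trans qm≤n n<q^1+K))) ⟩
    convℚ q (coeff f) (partialProdCoeff q f K) n       ≡⟨ partialProdCoeff-suc q f K n ⟨
    partialProdCoeff q f (suc K) n ∎
    where open ≡-Reasoning

  partialProdCoeff-eventually-constant : ∀ {n K} → n < q ℕ.^ K → ∀ k →
    partialProdCoeff q f (k ℕ.+ K) n ≡ partialProdCoeff q f K n
  partialProdCoeff-eventually-constant n<q^K zero    = refl
  partialProdCoeff-eventually-constant {n} {K} n<q^K (suc k) =
    trans (partialProdCoeff-stable (k ℕ.+ K) n
            (ℕP.<-≤-trans n<q^K (ℕP.^-monoʳ-≤ q (ℕP.m≤n+m K k))))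
          (partialProdCoeff-eventually-constant n<q^K k)

  infProd-≡-partialProdCoeff : ∀ {n K} → n ≤ K → infProd q f n ≡ partialProdCoeff q f K n
  infProd-≡-partialProdCoeff {n} {K} n≤K = begin
    partialProdCoeff q f (1 ℕ.+ n) n
      ≡⟨ partialProdCoeff-eventually-constant (n<m^n 1<q n) 1 ⟩
    partialProdCoeff q f n n
      ≡⟨ partialProdCoeff-eventually-constant (n<m^n 1<q n) (K ℕ.∸ n) ⟨
    partialProdCoeff q f (K ℕ.∸ n ℕ.+ n) n
      ≡⟨ cong (λ L → partialProdCoeff q f L n) (ℕP.m∸n+n≡m n≤K) ⟩
    partialProdCoeff q f K n ∎
    where open ≡-Reasoning

  infProd-functional-equation : ∀ n → infProd q f n ≡ convℚ q (coeff f) (infProd q f) n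
  infProd-functional-equation n = trans (partialProdCoeff-suc q f n n)
    (convℚ-congʳ q (coeff f) n λ m qm≤n →
      sym (infProd-≡-partialProdCoeff (ℕP.≤-trans (ℕP.m≤n*m m q) qm≤n)))

  infProd-zero : infProd q f 0 ≡ 1ℚ
  infProd-zero = partialProdCoeff-stable 0 0 (s≤s z≤n)

automatic⇒common-denominator : ∀ {q} → 1 < q → ∀ {c} → IsAutomatic q c →
  ∃ λ D → NonZero D × ∀ n → D ClearsDenominatorOf c n
automatic⇒common-denominator {q} 1<q {c} (L , kernel) with common-denominator (map (λ s → s 0) L)
... | D , D≢0 , D-clears = D , D≢0 , clears
  where
  clears : ∀ n → D ClearsDenominatorOf c n
  clears n with kernel n n (n<m^n 1<q n)
  ... | s , s∈L , cₙ≡s =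
    subst (D ClearsDenominatorOf_)
      (trans (sym (cₙ≡s 0)) (cong c (cong (ℕ._+ n) (ℕP.*-zeroʳ (q ℕ.^ n)))))
      (All.lookup D-clears (∈-map⁺ (λ s → s 0) s∈L))

cleared-functional-equation : ∀ q {a b : ℕ → ℚ} {E D} {g h : ℕ → ℤ} →
  (∀ n → b n ≡ convℚ q a b n) →
  (∀ i → ι (+ E) *ℚ a i ≡ ι (g i)) → (∀ m → ι (+ D) *ℚ b m ≡ ι (h m)) →
  ∀ n → + E * h n ≡ convℤ q g h n
cleared-functional-equation q {a} {b} {E} {D} {g} {h} b≡a∘b Ea≡g Db≡h n = ι-injective (begin
  ι (+ E * h n)                          ≡⟨ ι-* (+ E) (h n) ⟩
  ι (+ E) *ℚ ι (h n)                     ≡⟨ cong (ι (+ E) *ℚ_) (Db≡h n) ⟨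
  ι (+ E) *ℚ (ι (+ D) *ℚ b n)            ≡⟨ ℚP.*-assoc (ι (+ E)) (ι (+ D)) (b n) ⟨
  ι (+ E) *ℚ ι (+ D) *ℚ b n              ≡⟨ cong (ι (+ E) *ℚ ι (+ D) *ℚ_) (b≡a∘b n) ⟩
  ι (+ E) *ℚ ι (+ D) *ℚ convℚ q a b n    ≡⟨ ι-convℤ q {ι (+ E)} {ι (+ D)} Ea≡g Db≡h n ⟩
  ι (convℤ q g h n) ∎)
  where open ≡-Reasoning

polynomial-common-denominator : ∀ f → ∃ λ E → NonZero E × ∀ i → E ClearsDenominatorOf coeff f i
polynomial-common-denominator f with common-denominator f
... | E , E≢0 , E-clears = E , E≢0 , All-coeff E-clears (clears-0ℚ E)

bounded-denominators⇒integral : ∀ q .{{_ : NonZero q}} f {F : ℕ → ℚ} →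
  (∀ n → F n ≡ convℚ q (coeff f) F n) →
  ∀ D .{{_ : NonZero D}} → (∀ n → D ClearsDenominatorOf F n) →
  ∀ {m} → F m ≢ 0ℚ → ∀ i → IsInteger (coeff f i)
bounded-denominators⇒integral q f {F} F≡f∘F D D-clears {m} Fₘ≢0 i
  with polynomial-common-denominator f
... | E , E≢0 , E-clears =
  cleared-numerator-divisible⇒integer {E} {{E≢0}} (proj₂ (E-clears i))
    (denominator-divides-numerators {H = H} (numerator-≢0 {D} (proj₂ (D-clears m)) Fₘ≢0)
      E {{E≢0}} {g} g≥length≡0 E*H≡g∘H i)
  where
  g H : ℕ → ℤ
  g j = proj₁ (E-clears j)
  H n = proj₁ (D-clears n)

  g≥length≡0 : ∀ j → length f ≤ j → g j ≡ 0ℤ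
  g≥length≡0 j f≤j = numerator-≡0 {E} (proj₂ (E-clears j)) (coeff-≥length f j f≤j)

  E*H≡g∘H : ∀ n → + E * H n ≡ convℤ q g H n
  E*H≡g∘H = cleared-functional-equation q {E = E} {D} F≡f∘F (proj₂ ∘ E-clears) (proj₂ ∘ D-clears)

proposition3p3 : (q : ℕ) → 2 ≤ q → (f : Poly) → coeff f 0 ≡ 1ℚ →
    IsAutomatic q (infProd q f) → ∀ (d : ℕ) → IsInteger (coeff f d)
proposition3p3 q 2≤q f f₀≡1 automatic with automatic⇒common-denominator 2≤q automatic
... | D , D≢0 , D-clears =
  bounded-denominators⇒integral q {{q≢0}} f (infProd-functional-equation 2≤q f₀≡1)
    D {{D≢0}} D-clears {0} (λ F₀≡0 → 1ℚ≢0ℚ (trans (sym (infProd-zero 2≤q f₀≡1)) F₀≡0))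
  where
  q≢0 : NonZero q
  q≢0 = ℕ.>-nonZero (ℕP.<⇒≤ 2≤q)

  1ℚ≢0ℚ : 1ℚ ≢ 0ℚ
  1ℚ≢0ℚ ()
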